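{- Let $X$ be a connected non-bipartite graph. If the first homology group $H_1(\mathcal N(X))$ of its neighborhood complex is torsion (every element has finite order), then $\chi(X)\geq 4$.
   Context: The neighborhood complex $\mathcal N(X)$ of a graph $X$ is the simplicial complex with vertex set $V(X)$ whose faces are exactly those sets $W\subseteq V(X)$ whose elements have a common neighbor in $X$. $H_1$ denotes the first (integral) singular/simplicial homology group of (the geometric realization of) this complex, and $\chi(X)$ is the chromatic number of $X$. -}

module Defs where

open import Data.Nat using (ℕ; zero; suc; NonZero)
open import Data.Fin using (Fin; zero; suc; _<_)
open import Data.Bool using (Bool; true; false)
open import Data.Integer using (ℤ; 0ℤ; _+_; _-_; _*_; +_)
open import Data.Product using (Σ; ∃; _×_; _,_)
open import Relation.Nullary using (¬_)
open import Relation.Binary.PropositionalEquality using (_≡_; _≢_)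

record Graph (n : ℕ) : Set where
  field
    adj   : Fin n → Fin n → Bool
    sym   : ∀ u v → adj u v ≡ adj v u
    irrefl : ∀ u → adj u u ≡ false

open Graph public

Adj : ∀ {n} → Graph n → Fin n → Fin n → Set
Adj X u v = adj X u v ≡ true

data Reachable {n} (X : Graph n) : Fin n → Fin n → Set where
  here : ∀ {u} → Reachable X u u
  step : ∀ {u v w} → Adj X u v → Reachable X v w → Reachable X u w

Connected : ∀ {n} → Graph n → Set
Connected X = ∀ u v → Reachable X u v

ProperColouring : ∀ {n} → Graph n → (k : ℕ) → (Fin n → Fin k) → Set
ProperColouring X k f = ∀ u v → Adj X u v → f u ≢ f v

Colourable : ∀ {n} → Graph n → ℕ → Set
Colourable X k = Σ (_ → Fin k) (ProperColouring X k)

Bipartite : ∀ {n} → Graph n → Set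
Bipartite X = Colourable X 2

-- χ(X) ≥ k  iff  X has no proper colouring with fewer than k colours
-- (by monotonicity it suffices to say: not (k-1)-colourable; we state it for all j < k)
ChromaticAtLeast : ∀ {n} → Graph n → ℕ → Set
ChromaticAtLeast X k = ∀ j → j Data.Nat.< k → ¬ Colourable X j

sumFin : ∀ n → (Fin n → ℤ) → ℤ
sumFin zero    f = 0ℤ
sumFin (suc n) f = f zero + sumFin n (λ i → f (suc i))

-- The neighborhood complex N(X) : faces = vertex sets with a common neighbour

CommonNbr2 : ∀ {n} → Graph n → Fin n → Fin n → Set
CommonNbr2 X a b = ∃ λ w → Adj X w a × Adj X w b

CommonNbr3 : ∀ {n} → Graph n → Fin n → Fin n → Fin n → Set
CommonNbr3 X a b c = ∃ λ w → Adj X w a × Adj X w b × Adj X w c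

Edge : ∀ {n} → Graph n → Fin n → Fin n → Set
Edge X a b = (a < b) × CommonNbr2 X a b

Triangle : ∀ {n} → Graph n → Fin n → Fin n → Fin n → Set
Triangle X a b c = (a < b) × (b < c) × CommonNbr3 X a b c

-- Simplicial integral chains, as coefficient functions on ordered tuples
-- that vanish outside the (increasingly ordered) simplices.
Chain1 : ∀ {n} → Graph n → Set
Chain1 {n} X = Σ (Fin n → Fin n → ℤ) λ c → ∀ a b → ¬ Edge X a b → c a b ≡ 0ℤ

Chain2 : ∀ {n} → Graph n → Set
Chain2 {n} X = Σ (Fin n → Fin n → Fin n → ℤ) λ d →
  ∀ a b c → ¬ Triangle X a b c → d a b c ≡ 0ℤ

-- ∂₁ [a,b] = b - a
∂₁ : ∀ {n} {X : Graph n} → Chain1 X → Fin n → ℤ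
∂₁ {n} (c , _) v = sumFin n (λ u → c u v) - sumFin n (λ w → c v w)

-- ∂₂ [a,b,c] = [b,c] - [a,c] + [a,b]
∂₂ : ∀ {n} {X : Graph n} → Chain2 X → Fin n → Fin n → ℤ
∂₂ {n} (d , _) a b =
  (sumFin n (λ x → d x a b) - sumFin n (λ x → d a x b)) + sumFin n (λ x → d a b x)

H₁Torsion : ∀ {n} → Graph n → Set
H₁Torsion {n} X =
  (z : Chain1 X) → (∀ v → ∂₁ {X = X} z v ≡ 0ℤ) →
  Σ ℕ λ m → NonZero m × Σ (Chain2 X) λ d →
    ∀ a b → (+ m) * Data.Product.proj₁ z a b ≡ ∂₂ {X = X} d a b

-- A proper 3-colouring f pulls back the oriented 1-cochain ω of the triangle K₃ to
-- φ(a, b) = ω(f a, f b).  The vertices of a face of 𝒩(X) avoid the colour of their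
-- common neighbour, so they use only two colours, and there φ is a cocycle; hence φ
-- pairs to 0 with every boundary.  On the other hand an odd closed walk C of X, run
-- twice and read off at every second vertex, is a 1-cycle of 𝒩(X) on which φ takes
-- the value −φ(C), an odd number.  So that cycle has infinite order in H₁(𝒩(X)).
module Submission where

open import Defs hiding (sym)
open import Data.Bool using (Bool; true; false; not; _xor_)
open import Data.Bool.Properties using (not-involutive; xor-same; not-distribʳ-xor)
import Data.Bool.Properties as Bool
open import Data.Fin using (Fin; zero; suc; inject≤)
open import Data.Fin.Properties using (_≟_; _<?_; <-cmp; all?; ¬∀⟶∃¬; inject≤-injective; 2↔Bool)
open import Data.Integer using (ℤ; 0ℤ; 1ℤ; _+_; _-_; _*_; -_; +_; ∣_∣)
import Data.Integer as ℤ
import Data.Integer.Properties as ℤ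
open import Data.Integer.Tactic.RingSolver using (solve-∀)
open import Data.Nat using (ℕ; zero; suc; NonZero; s≤s⁻¹)
import Data.Nat as ℕ
import Data.Nat.Properties as ℕ
open import Data.Empty using (⊥)
open import Data.Product using (Σ; ∃; ∃₂; _×_; _,_; proj₁; proj₂)
open import Data.Sum using (_⊎_; inj₁; inj₂)
open import Function using (_∘_)
open import Function.Bundles using (Inverse)
open import Relation.Binary.Definitions using (tri<; tri≈; tri>)
open import Relation.Binary.PropositionalEquality
open import Relation.Nullary using (¬_; Dec; yes; no; contradiction)
open import Relation.Nullary.Decidable
  using (from-yes; decidable-stable; ¬?; _×-dec_; _⊎-dec_; _→-dec_)

open import Algebra.Properties.Semiring.Sum ℤ.+-*-semiring
  using (sum; sum-syntax; sum-cong-≗; sum-replicate-zero; ∑-distrib-+; ∑-comm; *-distribˡ-sum)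

open ≡-Reasoning

*-vanishes-by-cases : {P : Set} {a b : ℤ} → (P → b ≡ 0ℤ) → (¬ P → a ≡ 0ℤ) → a * b ≡ 0ℤ
*-vanishes-by-cases {a = a} {b} onP offP with b ℤ.≟ 0ℤ
... | yes b≡0 = trans (cong (a *_) b≡0) (ℤ.*-zeroʳ a)
... | no  b≢0 = trans (cong (_* b) (offP (b≢0 ∘ onP))) (ℤ.*-zeroˡ b)

bit : Bool → ℤ
bit false = 0ℤ
bit true  = 1ℤ

±1-flips-parity : ∀ b k {p s} → p ≡ 1ℤ ⊎ p ≡ - 1ℤ → s ≡ + 2 * k + bit b →
                  ∃ λ k′ → p + s ≡ + 2 * k′ + bit (not b)
±1-flips-parity false k (inj₁ refl) refl = k , evenUp k
  where evenUp : ∀ k → 1ℤ + (+ 2 * k + 0ℤ) ≡ + 2 * k + 1ℤ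
        evenUp = solve-∀
±1-flips-parity false k (inj₂ refl) refl = k - 1ℤ , evenDown k
  where evenDown : ∀ k → - 1ℤ + (+ 2 * k + 0ℤ) ≡ + 2 * (k - 1ℤ) + 1ℤ
        evenDown = solve-∀
±1-flips-parity true  k (inj₁ refl) refl = k + 1ℤ , oddUp k
  where oddUp : ∀ k → 1ℤ + (+ 2 * k + 1ℤ) ≡ + 2 * (k + 1ℤ) + 0ℤ
        oddUp = solve-∀
±1-flips-parity true  k (inj₂ refl) refl = k , oddDown k
  where oddDown : ∀ k → - 1ℤ + (+ 2 * k + 1ℤ) ≡ + 2 * k + 0ℤ
        oddDown = solve-∀

i+i≡0⇒i≡0 : ∀ i → i + i ≡ 0ℤ → i ≡ 0ℤ
i+i≡0⇒i≡0 i i+i≡0 = ℤ.*-cancelˡ-≡ (+ 2) i 0ℤ (trans (double i) i+i≡0)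
  where
  double : ∀ i → + 2 * i ≡ i + i
  double = solve-∀

2k+1≢0 : ∀ k → + 2 * k + 1ℤ ≢ 0ℤ
2k+1≢0 k 2k+1≡0 = contradiction (ℕ.m*n≡1⇒m≡1 2 ∣ k ∣ ∣2k∣≡1) λ ()
  where
  2k≡-1 : + 2 * k ≡ - 1ℤ
  2k≡-1 = trans (shift (+ 2 * k)) (cong (_- 1ℤ) 2k+1≡0)
    where shift : ∀ i → i ≡ i + 1ℤ - 1ℤ
          shift = solve-∀
  ∣2k∣≡1 : 2 ℕ.* ∣ k ∣ ≡ 1
  ∣2k∣≡1 = trans (sym (ℤ.abs-* (+ 2) k)) (cong ∣_∣ 2k≡-1)

sumFin≡∑ : ∀ n (f : Fin n → ℤ) → sumFin n f ≡ ∑[ i < n ] f i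
sumFin≡∑ zero    f = refl
sumFin≡∑ (suc n) f = cong (λ s → f zero + s) (sumFin≡∑ n (f ∘ suc))

∑-distrib-− : ∀ {n} (f g : Fin n → ℤ) →
              ∑[ i < n ] (f i - g i) ≡ ∑[ i < n ] f i - ∑[ i < n ] g i
∑-distrib-− {zero}  f g = refl
∑-distrib-− {suc n} f g =
  trans (cong (λ s → f zero - g zero + s) (∑-distrib-− (f ∘ suc) (g ∘ suc)))
        (regroup (f zero) (g zero) (sum (f ∘ suc)) (sum (g ∘ suc)))
  where
  regroup : ∀ a b c d → a - b + (c - d) ≡ a + c - (b + d)
  regroup = solve-∀

∑-distrib-−+ : ∀ {n} (f g h : Fin n → ℤ) →
               ∑[ i < n ] (f i - g i + h i) ≡ ∑[ i < n ] f i - ∑[ i < n ] g i + ∑[ i < n ] h i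
∑-distrib-−+ f g h =
  trans (∑-distrib-+ (λ i → f i - g i) h) (cong (_+ sum h) (∑-distrib-− f g))

∑³ : ∀ {n} → (Fin n → Fin n → Fin n → ℤ) → ℤ
∑³ {n} F = ∑[ p < n ] ∑[ q < n ] ∑[ r < n ] F p q r

∑³-distrib-−+ : ∀ {n} (F G H : Fin n → Fin n → Fin n → ℤ) →
                ∑³ (λ p q r → F p q r - G p q r + H p q r) ≡ ∑³ F - ∑³ G + ∑³ H
∑³-distrib-−+ {n} F G H =
  trans (sum-cong-≗ λ p → trans (sum-cong-≗ λ q → ∑-distrib-−+ (F p q) (G p q) (H p q))
                                (∑-distrib-−+ (inner F p) (inner G p) (inner H p)))
        (∑-distrib-−+ (middle F) (middle G) (middle H))
  where
  inner : (Fin n → Fin n → Fin n → ℤ) → Fin n → Fin n → ℤ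
  inner K p q = ∑[ r < n ] K p q r
  middle : (Fin n → Fin n → Fin n → ℤ) → Fin n → ℤ
  middle K p = ∑[ q < n ] ∑[ r < n ] K p q r

∑³-zero : ∀ n → ∑³ {n} (λ _ _ _ → 0ℤ) ≡ 0ℤ
∑³-zero n = begin
  ∑[ p < n ] ∑[ q < n ] ∑[ r < n ] 0ℤ ≡⟨ sum-cong-≗ {n} (λ _ → sum-cong-≗ {n} λ _ → sum-replicate-zero n) ⟩
  ∑[ p < n ] ∑[ q < n ] 0ℤ            ≡⟨ sum-cong-≗ {n} (λ _ → sum-replicate-zero n) ⟩
  ∑[ p < n ] 0ℤ                       ≡⟨ sum-replicate-zero n ⟩
  0ℤ                                  ∎

⟦_⟧ : {P : Set} → Dec P → ℤ
⟦ yes _ ⟧ = 1ℤ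
⟦ no  _ ⟧ = 0ℤ

⟦⟧-yes : {P : Set} (p? : Dec P) → P → ⟦ p? ⟧ ≡ 1ℤ
⟦⟧-yes (yes _) _ = refl
⟦⟧-yes (no ¬p) p = contradiction p ¬p

⟦⟧-no : {P : Set} (p? : Dec P) → ¬ P → ⟦ p? ⟧ ≡ 0ℤ
⟦⟧-no (yes p) ¬p = contradiction p ¬p
⟦⟧-no (no _)  _  = refl

module _ {n : ℕ} where

  δ : Fin n → Fin n → ℤ
  δ x y = ⟦ x ≟ y ⟧

  lt : Fin n → Fin n → ℤ
  lt x y = ⟦ x <? y ⟧

  lt+lt≡1-δ : ∀ x y → lt x y + lt y x ≡ 1ℤ - δ x y
  lt+lt≡1-δ x y with <-cmp x y
  ... | tri< x<y x≢y y≮x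
    rewrite ⟦⟧-yes (x <? y) x<y | ⟦⟧-no (y <? x) y≮x | ⟦⟧-no (x ≟ y) x≢y = refl
  ... | tri≈ x≮y x≡y y≮x
    rewrite ⟦⟧-no (x <? y) x≮y | ⟦⟧-no (y <? x) y≮x | ⟦⟧-yes (x ≟ y) x≡y = refl
  ... | tri> x≮y x≢y y<x
    rewrite ⟦⟧-no (x <? y) x≮y | ⟦⟧-yes (y <? x) y<x | ⟦⟧-no (x ≟ y) x≢y = refl

δ-suc : ∀ {n} (x y : Fin n) → δ (suc x) (suc y) ≡ δ x y
δ-suc x y with x ≟ y
... | yes _ = refl
... | no  _ = refl

∑-δ : ∀ {n} (x : Fin n) (h : Fin n → ℤ) → ∑[ a < n ] (δ x a * h a) ≡ h x
∑-δ {suc n} zero h = begin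
  1ℤ * h zero + ∑[ a < n ] (0ℤ * h (suc a))  ≡⟨ cong₂ _+_ (ℤ.*-identityˡ (h zero))
                                                        (sum-cong-≗ (ℤ.*-zeroˡ ∘ h ∘ suc)) ⟩
  h zero + ∑[ a < n ] 0ℤ                     ≡⟨ cong (λ s → h zero + s) (sum-replicate-zero n) ⟩
  h zero + 0ℤ                                ≡⟨ ℤ.+-identityʳ (h zero) ⟩
  h zero                                     ∎
∑-δ {suc n} (suc x) h = begin
  0ℤ * h zero + ∑[ a < n ] (δ (suc x) (suc a) * h (suc a))
    ≡⟨ cong₂ _+_ (ℤ.*-zeroˡ (h zero)) (sum-cong-≗ λ a → cong (_* h (suc a)) (δ-suc x a)) ⟩
  0ℤ + ∑[ a < n ] (δ x a * h (suc a))
    ≡⟨ ℤ.+-identityˡ _ ⟩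
  ∑[ a < n ] (δ x a * h (suc a))
    ≡⟨ ∑-δ x (h ∘ suc) ⟩
  h (suc x) ∎

∑-δ-δ : ∀ {n} (x y : Fin n) (g h : Fin n → ℤ) →
        ∑[ a < n ] (δ x a * g a - δ y a * h a) ≡ g x - h y
∑-δ-δ x y g h = trans (∑-distrib-− (λ a → δ x a * g a) (λ a → δ y a * h a)) (cong₂ _-_ (∑-δ x g) (∑-δ y h))

Coeffs : ℕ → Set
Coeffs n = Fin n → Fin n → ℤ

module _ {n : ℕ} where

  ∂ : Coeffs n → Fin n → ℤ
  ∂ c v = ∑[ u < n ] c u v - ∑[ w < n ] c v w

  ⟪_,_⟫ : Coeffs n → Coeffs n → ℤ
  ⟪ φ , c ⟫ = ∑[ a < n ] ∑[ b < n ] (φ a b * c a b)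

  -- The oriented simplex [x, y] written on increasing pairs: it is −[y, x] when y < x
  -- and vanishes when x = y.
  edge : Fin n → Fin n → Coeffs n
  edge x y a b = lt a b * (δ x a * δ y b - δ y a * δ x b)

  coboundary : Coeffs n → Fin n → Fin n → Fin n → ℤ
  coboundary φ p q r = φ q r - φ p r + φ p q

  Alternating : Coeffs n → Set
  Alternating φ = (∀ x → φ x x ≡ 0ℤ) × (∀ x y → φ y x ≡ - φ x y)

  ∂-+ : ∀ (c c′ : Coeffs n) v → ∂ (λ a b → c a b + c′ a b) v ≡ ∂ c v + ∂ c′ v
  ∂-+ c c′ v = begin
    ∑[ u < n ] (c u v + c′ u v) - ∑[ w < n ] (c v w + c′ v w)
      ≡⟨ cong₂ _-_ (∑-distrib-+ (λ u → c u v) (λ u → c′ u v))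
                   (∑-distrib-+ (c v) (c′ v)) ⟩
    (∑[ u < n ] c u v + ∑[ u < n ] c′ u v) - (∑[ w < n ] c v w + ∑[ w < n ] c′ v w)
      ≡⟨ regroup (sum (λ u → c u v)) (sum (λ u → c′ u v)) (sum (c v)) (sum (c′ v)) ⟩
    ∂ c v + ∂ c′ v ∎
    where
    regroup : ∀ a b c d → (a + b) - (c + d) ≡ (a - c) + (b - d)
    regroup = solve-∀

  ∂-edge : ∀ x y v → ∂ (edge x y) v ≡ δ y v - δ x v
  ∂-edge x y v = begin
    ∑[ u < n ] edge x y u v - ∑[ w < n ] edge x y v w
      ≡⟨ cong₂ _-_ (sum-cong-≗ λ u → inEnd (lt u v) (δ x u) (δ y v) (δ y u) (δ x v))
                   (sum-cong-≗ λ w → inStart (lt v w) (δ x v) (δ y w) (δ y v) (δ x w)) ⟩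
    ∑[ u < n ] (δ x u * (lt u v * δ y v) - δ y u * (lt u v * δ x v))
      - ∑[ w < n ] (δ y w * (lt v w * δ x v) - δ x w * (lt v w * δ y v))
      ≡⟨ cong₂ _-_ (∑-δ-δ x y (λ u → lt u v * δ y v) (λ u → lt u v * δ x v))
                   (∑-δ-δ y x (λ w → lt v w * δ x v) (λ w → lt v w * δ y v)) ⟩
    (lt x v * δ y v - lt y v * δ x v) - (lt v y * δ x v - lt v x * δ y v)
      ≡⟨ collect (lt x v) (lt v x) (lt y v) (lt v y) (δ y v) (δ x v) ⟩
    δ y v * (lt x v + lt v x) - δ x v * (lt y v + lt v y)
      ≡⟨ cong₂ (λ s t → δ y v * s - δ x v * t) (lt+lt≡1-δ x v) (lt+lt≡1-δ y v) ⟩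
    δ y v * (1ℤ - δ x v) - δ x v * (1ℤ - δ y v)
      ≡⟨ cancel (δ y v) (δ x v) ⟩
    δ y v - δ x v ∎
    where
    inEnd : ∀ l a b c d → l * (a * b - c * d) ≡ a * (l * b) - c * (l * d)
    inEnd = solve-∀
    inStart : ∀ l a b c d → l * (a * b - c * d) ≡ b * (l * a) - d * (l * c)
    inStart = solve-∀
    collect : ∀ l₁ l₂ l₃ l₄ p q →
              (l₁ * p - l₃ * q) - (l₄ * q - l₂ * p) ≡ p * (l₁ + l₂) - q * (l₃ + l₄)
    collect = solve-∀
    cancel : ∀ p q → p * (1ℤ - q) - q * (1ℤ - p) ≡ p - q
    cancel = solve-∀

  ⟪⟫-zeroʳ : ∀ φ → ⟪ φ , (λ _ _ → 0ℤ) ⟫ ≡ 0ℤ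
  ⟪⟫-zeroʳ φ = begin
    ∑[ a < n ] ∑[ b < n ] (φ a b * 0ℤ) ≡⟨ sum-cong-≗ (λ a → sum-cong-≗ λ b → ℤ.*-zeroʳ (φ a b)) ⟩
    ∑[ a < n ] ∑[ b < n ] 0ℤ            ≡⟨ sum-cong-≗ {n} (λ _ → sum-replicate-zero n) ⟩
    ∑[ a < n ] 0ℤ                       ≡⟨ sum-replicate-zero n ⟩
    0ℤ                                  ∎

  ⟪⟫-+ : ∀ φ (c c′ : Coeffs n) → ⟪ φ , (λ a b → c a b + c′ a b) ⟫ ≡ ⟪ φ , c ⟫ + ⟪ φ , c′ ⟫
  ⟪⟫-+ φ c c′ = begin
    ∑[ a < n ] ∑[ b < n ] (φ a b * (c a b + c′ a b))
      ≡⟨ sum-cong-≗ (λ a → sum-cong-≗ λ b → ℤ.*-distribˡ-+ (φ a b) (c a b) (c′ a b)) ⟩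
    ∑[ a < n ] ∑[ b < n ] (φ a b * c a b + φ a b * c′ a b)
      ≡⟨ sum-cong-≗ (λ a → ∑-distrib-+ (λ b → φ a b * c a b) (λ b → φ a b * c′ a b)) ⟩
    ∑[ a < n ] (∑[ b < n ] (φ a b * c a b) + ∑[ b < n ] (φ a b * c′ a b))
      ≡⟨ ∑-distrib-+ (λ a → ∑[ b < n ] (φ a b * c a b)) (λ a → ∑[ b < n ] (φ a b * c′ a b)) ⟩
    ⟪ φ , c ⟫ + ⟪ φ , c′ ⟫ ∎

  ⟪⟫-*ʳ : ∀ φ (m : ℤ) (c : Coeffs n) → ⟪ φ , (λ a b → m * c a b) ⟫ ≡ m * ⟪ φ , c ⟫
  ⟪⟫-*ʳ φ m c = begin
    ∑[ a < n ] ∑[ b < n ] (φ a b * (m * c a b))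
      ≡⟨ sum-cong-≗ (λ a → sum-cong-≗ λ b → swap (φ a b) m (c a b)) ⟩
    ∑[ a < n ] ∑[ b < n ] (m * (φ a b * c a b))
      ≡⟨ sum-cong-≗ (λ a → sym (*-distribˡ-sum m (λ b → φ a b * c a b))) ⟩
    ∑[ a < n ] (m * ∑[ b < n ] (φ a b * c a b))
      ≡⟨ sym (*-distribˡ-sum m (λ a → ∑[ b < n ] (φ a b * c a b))) ⟩
    m * ⟪ φ , c ⟫ ∎
    where
    swap : ∀ f m c → f * (m * c) ≡ m * (f * c)
    swap = solve-∀

  ⟪⟫-edge : ∀ φ → Alternating φ → ∀ x y → ⟪ φ , edge x y ⟫ ≡ φ x y
  ⟪⟫-edge φ (φ-diag , φ-anti) x y = begin
    ∑[ a < n ] ∑[ b < n ] (φ a b * edge x y a b)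
      ≡⟨ sum-cong-≗ (λ a → sum-cong-≗ λ b → inner (φ a b) (lt a b) (δ x a) (δ y b) (δ y a) (δ x b)) ⟩
    ∑[ a < n ] ∑[ b < n ] (δ y b * (φ a b * lt a b * δ x a) - δ x b * (φ a b * lt a b * δ y a))
      ≡⟨ sum-cong-≗ (λ a → ∑-δ-δ y x (λ b → φ a b * lt a b * δ x a) (λ b → φ a b * lt a b * δ y a)) ⟩
    ∑[ a < n ] (φ a y * lt a y * δ x a - φ a x * lt a x * δ y a)
      ≡⟨ sum-cong-≗ (λ a → outer (φ a y * lt a y) (δ x a) (φ a x * lt a x) (δ y a)) ⟩
    ∑[ a < n ] (δ x a * (φ a y * lt a y) - δ y a * (φ a x * lt a x))
      ≡⟨ ∑-δ-δ x y (λ a → φ a y * lt a y) (λ a → φ a x * lt a x) ⟩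
    φ x y * lt x y - φ y x * lt y x
      ≡⟨ cong (λ t → φ x y * lt x y - t * lt y x) (φ-anti x y) ⟩
    φ x y * lt x y - - φ x y * lt y x
      ≡⟨ factor (φ x y) (lt x y) (lt y x) ⟩
    φ x y * (lt x y + lt y x)
      ≡⟨ cong (φ x y *_) (lt+lt≡1-δ x y) ⟩
    φ x y * (1ℤ - δ x y)
      ≡⟨ expand (φ x y) (δ x y) ⟩
    φ x y - δ x y * φ x y
      ≡⟨ cong (λ t → φ x y - t) (δ*φ≡0 x y) ⟩
    φ x y - 0ℤ
      ≡⟨ ℤ.+-identityʳ (φ x y) ⟩
    φ x y ∎
    where
    inner : ∀ f l a b c d → f * (l * (a * b - c * d)) ≡ b * (f * l * a) - d * (f * l * c)
    inner = solve-∀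
    outer : ∀ p a q b → p * a - q * b ≡ a * p - b * q
    outer = solve-∀
    factor : ∀ f l m → f * l - - f * m ≡ f * (l + m)
    factor = solve-∀
    expand : ∀ f d → f * (1ℤ - d) ≡ f - d * f
    expand = solve-∀
    δ*φ≡0 : ∀ x y → δ x y * φ x y ≡ 0ℤ
    δ*φ≡0 x y with x ≟ y
    ... | yes refl = trans (ℤ.*-identityˡ (φ x x)) (φ-diag x)
    ... | no  _    = refl

module _ {n : ℕ} (X : Graph n) where

  IsCocycle : Coeffs n → Set
  IsCocycle φ = ∀ p q r → Triangle X p q r → coboundary φ p q r ≡ 0ℤ

  ∂₁≡∂ : ∀ (z : Chain1 X) v → ∂₁ {X = X} z v ≡ ∂ (proj₁ z) v
  ∂₁≡∂ (c , _) v = cong₂ _-_ (sumFin≡∑ n (λ u → c u v)) (sumFin≡∑ n (c v))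

  ∂₂≡∑ : ∀ (d : Chain2 X) a b →
         ∂₂ {X = X} d a b ≡ ∑[ x < n ] (proj₁ d x a b - proj₁ d a x b + proj₁ d a b x)
  ∂₂≡∑ (D , _) a b = begin
    sumFin n (λ x → D x a b) - sumFin n (λ x → D a x b) + sumFin n (D a b)
      ≡⟨ cong₂ _+_ (cong₂ _-_ (sumFin≡∑ n (λ x → D x a b)) (sumFin≡∑ n (λ x → D a x b)))
                   (sumFin≡∑ n (D a b)) ⟩
    ∑[ x < n ] D x a b - ∑[ x < n ] D a x b + ∑[ x < n ] D a b x
      ≡⟨ sym (∑-distrib-−+ (λ x → D x a b) (λ x → D a x b) (D a b)) ⟩
    ∑[ x < n ] (D x a b - D a x b + D a b x) ∎

  ⟪⟫-∂₂≡∑coboundary : ∀ φ (d : Chain2 X) →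
    ⟪ φ , ∂₂ {X = X} d ⟫ ≡ ∑³ (λ p q r → proj₁ d p q r * coboundary φ p q r)
  ⟪⟫-∂₂≡∑coboundary φ d@(D , _) = begin
    ∑[ a < n ] ∑[ b < n ] (φ a b * ∂₂ {X = X} d a b)
      ≡⟨ sum-cong-≗ (λ a → sum-cong-≗ λ b → cong (φ a b *_) (∂₂≡∑ d a b)) ⟩
    ∑[ a < n ] ∑[ b < n ] (φ a b * ∑[ x < n ] (D x a b - D a x b + D a b x))
      ≡⟨ sum-cong-≗ (λ a → sum-cong-≗ λ b →
           *-distribˡ-sum (φ a b) (λ x → D x a b - D a x b + D a b x)) ⟩
    ∑³ (λ a b x → φ a b * (D x a b - D a x b + D a b x))
      ≡⟨ sum-cong-≗ (λ a → sum-cong-≗ λ b → sum-cong-≗ λ x →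
           spread (φ a b) (D x a b) (D a x b) (D a b x)) ⟩
    ∑³ (λ a b x → D x a b * φ a b - D a x b * φ a b + D a b x * φ a b)
      ≡⟨ ∑³-distrib-−+ (λ a b x → D x a b * φ a b) (λ a b x → D a x b * φ a b)
                       (λ a b x → D a b x * φ a b) ⟩
    ∑³ (λ a b x → D x a b * φ a b) - ∑³ (λ a b x → D a x b * φ a b)
      + ∑³ (λ a b x → D a b x * φ a b)
      ≡⟨ cong₂ _+_ (cong₂ _-_ firstToFront middleToMiddle) refl ⟩
    ∑³ (λ p q r → D p q r * φ q r) - ∑³ (λ p q r → D p q r * φ p r)
      + ∑³ (λ p q r → D p q r * φ p q)
      ≡⟨ ∑³-distrib-−+ (λ p q r → D p q r * φ q r) (λ p q r → D p q r * φ p r)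
                       (λ p q r → D p q r * φ p q) ⟨
    ∑³ (λ p q r → D p q r * φ q r - D p q r * φ p r + D p q r * φ p q)
      ≡⟨ sum-cong-≗ (λ p → sum-cong-≗ λ q → sum-cong-≗ λ r →
           factor (D p q r) (φ q r) (φ p r) (φ p q)) ⟩
    ∑³ (λ p q r → D p q r * coboundary φ p q r) ∎
    where
    spread : ∀ f a b c → f * (a - b + c) ≡ a * f - b * f + c * f
    spread = solve-∀
    factor : ∀ d a b c → d * a - d * b + d * c ≡ d * (a - b + c)
    factor = solve-∀
    firstToFront : ∑³ (λ a b x → D x a b * φ a b) ≡ ∑³ (λ p q r → D p q r * φ q r)
    firstToFront = trans (sum-cong-≗ λ a → ∑-comm (λ b x → D x a b * φ a b))
                         (∑-comm (λ a x → ∑[ b < n ] (D x a b * φ a b)))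
    middleToMiddle : ∑³ (λ a b x → D a x b * φ a b) ≡ ∑³ (λ p q r → D p q r * φ p r)
    middleToMiddle = sum-cong-≗ λ a → ∑-comm (λ b x → D a x b * φ a b)

  ⟪⟫-∂₂ : ∀ φ → IsCocycle φ → (d : Chain2 X) → ⟪ φ , ∂₂ {X = X} d ⟫ ≡ 0ℤ
  ⟪⟫-∂₂ φ cocycle d@(D , D-vanishes) = begin
    ⟪ φ , ∂₂ {X = X} d ⟫
      ≡⟨ ⟪⟫-∂₂≡∑coboundary φ d ⟩
    ∑³ (λ p q r → D p q r * coboundary φ p q r)
      ≡⟨ sum-cong-≗ (λ p → sum-cong-≗ λ q → sum-cong-≗ λ r →
           *-vanishes-by-cases (cocycle p q r) (D-vanishes p q r)) ⟩
    ∑³ {n} (λ _ _ _ → 0ℤ)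
      ≡⟨ ∑³-zero n ⟩
    0ℤ ∎

  ⟪⟫-torsion : ∀ φ → IsCocycle φ → (z : Chain1 X) →
               (Σ ℕ λ m → NonZero m × Σ (Chain2 X) λ d →
                 ∀ a b → + m * proj₁ z a b ≡ ∂₂ {X = X} d a b) →
               ⟪ φ , proj₁ z ⟫ ≡ 0ℤ
  ⟪⟫-torsion φ cocycle (c , _) (m , m≢0 , d , mc≡∂d) = ℤ.*-cancelˡ-≡ (+ m) ⟪ φ , c ⟫ 0ℤ {{m≢0}} (begin
    + m * ⟪ φ , c ⟫                ≡⟨ sym (⟪⟫-*ʳ φ (+ m) c) ⟩
    ⟪ φ , (λ a b → + m * c a b) ⟫  ≡⟨ sum-cong-≗ (λ a → sum-cong-≗ λ b → cong (φ a b *_) (mc≡∂d a b)) ⟩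
    ⟪ φ , ∂₂ {X = X} d ⟫           ≡⟨ ⟪⟫-∂₂ φ cocycle d ⟩
    0ℤ                             ≡⟨ sym (ℤ.*-zeroʳ (+ m)) ⟩
    + m * 0ℤ                       ∎)

module _ {n : ℕ} {X : Graph n} where

  _++ʷ_ : ∀ {a b c} → Reachable X a b → Reachable X b c → Reachable X a c
  here     ++ʷ B = B
  step e A ++ʷ B = step e (A ++ʷ B)

  reverseʷ : ∀ {a b} → Reachable X a b → Reachable X b a
  reverseʷ here       = here
  reverseʷ (step e A) = reverseʷ A ++ʷ step (trans (Graph.sym X _ _) e) here

  parity : ∀ {a b} → Reachable X a b → Bool
  parity here       = false
  parity (step _ A) = not (parity A)

  parity-++ : ∀ {a b c} (A : Reachable X a b) (B : Reachable X b c) →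
              parity (A ++ʷ B) ≡ parity A xor parity B
  parity-++ here       B = refl
  parity-++ (step _ A) B = trans (cong not (parity-++ A B)) (Bool.not-distribˡ-xor (parity A) (parity B))

  parity-reverse : ∀ {a b} (A : Reachable X a b) → parity (reverseʷ A) ≡ parity A
  parity-reverse here       = refl
  parity-reverse (step _ A) = begin
    parity (reverseʷ A ++ʷ step _ here) ≡⟨ parity-++ (reverseʷ A) _ ⟩
    parity (reverseʷ A) xor true         ≡⟨ cong (_xor true) (parity-reverse A) ⟩
    parity A xor true                    ≡⟨ Bool.xor-comm (parity A) true ⟩
    not (parity A)                       ∎

data NbrWalk {n : ℕ} (X : Graph n) : Fin n → Fin n → Set where
  []  : ∀ {a} → NbrWalk X a a
  _∷_ : ∀ {a b c} → CommonNbr2 X a b → NbrWalk X b c → NbrWalk X a c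

module _ {n : ℕ} {X : Graph n} where

  -- Two consecutive steps a – w – c become one step a ~ c of 𝒩(X) through the common
  -- neighbour w.
  halve : ∀ {a b} (W : Reachable X a b) → parity W ≡ false → NbrWalk X a b
  halve here                    _    = []
  halve (step _ here)           ()
  halve (step a~w (step w~c W)) even =
    (_ , trans (Graph.sym X _ _) a~w , w~c) ∷ halve W (trans (sym (not-involutive _)) even)

  module _ (φ : Coeffs n) where

    walkSum : ∀ {a b} → Reachable X a b → ℤ
    walkSum here                   = 0ℤ
    walkSum (step {u} {v} _ W) = φ u v + walkSum W

    nbrWalkSum : ∀ {a b} → NbrWalk X a b → ℤ
    nbrWalkSum []                  = 0ℤ
    nbrWalkSum (_∷_ {a} {c} _ N) = φ a c + nbrWalkSum N

    walkSum-++ : ∀ {a b c} (A : Reachable X a b) (B : Reachable X b c) →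
                 walkSum (A ++ʷ B) ≡ walkSum A + walkSum B
    walkSum-++ here               B = sym (ℤ.+-identityˡ (walkSum B))
    walkSum-++ (step {u} {v} _ A) B =
      trans (cong (λ s → φ u v + s) (walkSum-++ A B)) (sym (ℤ.+-assoc (φ u v) (walkSum A) (walkSum B)))

    walkSum-parity : (∀ {x y} → Adj X x y → φ x y ≡ 1ℤ ⊎ φ x y ≡ - 1ℤ) →
                     ∀ {a b} (W : Reachable X a b) → ∃ λ k → walkSum W ≡ + 2 * k + bit (parity W)
    walkSum-parity unit here = 0ℤ , refl
    walkSum-parity unit (step e W) with walkSum-parity unit W
    ... | k , sumW = ±1-flips-parity (parity W) k (unit e) sumW

    walkSum-halve : (∀ {x y z} → Adj X x y → Adj X y z → + 2 * φ x z + φ x y + φ y z ≡ 0ℤ) →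
                    ∀ {a b} (W : Reachable X a b) (even : parity W ≡ false) →
                    + 2 * nbrWalkSum (halve W even) + walkSum W ≡ 0ℤ
    walkSum-halve path here          _  = refl
    walkSum-halve path (step _ here) ()
    walkSum-halve path (step {a} {w} a~w (step {v = c} w~c W)) even = begin
      + 2 * (φ a c + nbrWalkSum (halve W even′)) + (φ a w + (φ w c + walkSum W))
        ≡⟨ regroup (φ a c) (nbrWalkSum (halve W even′)) (φ a w) (φ w c) (walkSum W) ⟩
      (+ 2 * φ a c + φ a w + φ w c) + (+ 2 * nbrWalkSum (halve W even′) + walkSum W)
        ≡⟨ cong₂ _+_ (path a~w w~c) (walkSum-halve path W even′) ⟩
      0ℤ ∎
      where
      even′ : parity W ≡ false
      even′ = trans (sym (not-involutive _)) even
      regroup : ∀ p q r s t → + 2 * (p + q) + (r + (s + t)) ≡ (+ 2 * p + r + s) + (+ 2 * q + t)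
      regroup = solve-∀

  edge-vanishes : ∀ {x y a b} → CommonNbr2 X x y → ¬ Edge X a b → edge x y a b ≡ 0ℤ
  edge-vanishes {x} {y} {a} {b} (w , w~x , w~y) ¬ab with a <? b
  ... | no  _   = refl
  ... | yes a<b = cong (1ℤ *_) (cong₂ _-_ (δδ≡0 x a y b λ { refl refl → ¬ab (a<b , w , w~x , w~y) })
                                          (δδ≡0 y a x b λ { refl refl → ¬ab (a<b , w , w~y , w~x) }))
    where
    δδ≡0 : ∀ (p q r s : Fin n) → (p ≡ q → r ≡ s → ⊥) → δ p q * δ r s ≡ 0ℤ
    δδ≡0 p q r s h = *-vanishes-by-cases (λ p≡q → ⟦⟧-no (r ≟ s) (h p≡q)) (⟦⟧-no (p ≟ q))

  chain : ∀ {a b} → NbrWalk X a b → Coeffs n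
  chain []                x y = 0ℤ
  chain (_∷_ {a} {c} _ N) x y = edge a c x y + chain N x y

  chain-vanishes : ∀ {a b} (N : NbrWalk X a b) x y → ¬ Edge X x y → chain N x y ≡ 0ℤ
  chain-vanishes []           x y _   = refl
  chain-vanishes (a~c ∷ N) x y ¬xy = cong₂ _+_ (edge-vanishes a~c ¬xy) (chain-vanishes N x y ¬xy)

  ∂-chain : ∀ {a b} (N : NbrWalk X a b) v → ∂ (chain N) v ≡ δ b v - δ a v
  ∂-chain {a} [] v = begin
    ∑[ u < n ] 0ℤ - ∑[ w < n ] 0ℤ ≡⟨ cong₂ _-_ (sum-replicate-zero n) (sum-replicate-zero n) ⟩
    0ℤ                            ≡⟨ sym (ℤ.+-inverseʳ (δ a v)) ⟩
    δ a v - δ a v                 ∎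
  ∂-chain {a} {b} (_∷_ {b = c} _ N) v = begin
    ∂ (λ x y → edge a c x y + chain N x y) v ≡⟨ ∂-+ (edge a c) (chain N) v ⟩
    ∂ (edge a c) v + ∂ (chain N) v          ≡⟨ cong₂ _+_ (∂-edge a c v) (∂-chain N v) ⟩
    (δ c v - δ a v) + (δ b v - δ c v)       ≡⟨ telescope (δ a v) (δ b v) (δ c v) ⟩
    δ b v - δ a v                           ∎
    where
    telescope : ∀ p q r → (r - p) + (q - r) ≡ q - p
    telescope = solve-∀

  ⟪⟫-chain : ∀ φ → Alternating φ → ∀ {a b} (N : NbrWalk X a b) → ⟪ φ , chain N ⟫ ≡ nbrWalkSum φ N
  ⟪⟫-chain φ alt []                  = ⟪⟫-zeroʳ φ
  ⟪⟫-chain φ alt (_∷_ {a} {c} _ N) =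
    trans (⟪⟫-+ φ (edge a c) (chain N)) (cong₂ _+_ (⟪⟫-edge φ alt a c) (⟪⟫-chain φ alt N))

-- The 1-cochain of the oriented triangle K₃: +1 along 0 → 1 → 2 → 0, −1 against it.
ω : Fin 3 → Fin 3 → ℤ
ω zero             (suc zero)       = 1ℤ
ω (suc zero)       (suc (suc zero)) = 1ℤ
ω (suc (suc zero)) zero             = 1ℤ
ω (suc zero)       zero             = - 1ℤ
ω (suc (suc zero)) (suc zero)       = - 1ℤ
ω zero             (suc (suc zero)) = - 1ℤ
ω _                _                = 0ℤ

ω-alternating : Alternating ω
ω-alternating = from-yes (all? λ x → ω x x ℤ.≟ 0ℤ)
              , from-yes (all? λ x → all? λ y → ω y x ℤ.≟ - ω x y)

ω-unit : ∀ x y → x ≢ y → ω x y ≡ 1ℤ ⊎ ω x y ≡ - 1ℤ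
ω-unit = from-yes (all? λ x → all? λ y →
  ¬? (x ≟ y) →-dec (ω x y ℤ.≟ 1ℤ ⊎-dec ω x y ℤ.≟ - 1ℤ))

ω-path : ∀ x y z → x ≢ y → y ≢ z → + 2 * ω x z + ω x y + ω y z ≡ 0ℤ
ω-path = from-yes (all? λ x → all? λ y → all? λ z →
  ¬? (x ≟ y) →-dec ¬? (y ≟ z) →-dec (+ 2 * ω x z + ω x y + ω y z ℤ.≟ 0ℤ))

-- Only two values occur among x, y and z, so two of them coincide and the identity
-- reduces to ω being alternating.
ω-cocycle : ∀ x y z w → x ≢ w → y ≢ w → z ≢ w → coboundary ω x y z ≡ 0ℤ
ω-cocycle = from-yes (all? λ x → all? λ y → all? λ z → all? λ w →
  ¬? (x ≟ w) →-dec ¬? (y ≟ w) →-dec ¬? (z ≟ w) →-dec (ω y z - ω x z + ω x y ℤ.≟ 0ℤ))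

module _ {n : ℕ} (X : Graph n) (f : Fin n → Fin 3) (proper : ProperColouring X 3 f) where

  φ : Coeffs n
  φ a b = ω (f a) (f b)

  φ-alternating : Alternating φ
  φ-alternating = (λ a → proj₁ ω-alternating (f a)) , (λ a b → proj₂ ω-alternating (f a) (f b))

  φ-cocycle : IsCocycle X φ
  φ-cocycle p q r (_ , _ , w , w~p , w~q , w~r) =
    ω-cocycle (f p) (f q) (f r) (f w) (≢-sym (proper w p w~p)) (≢-sym (proper w q w~q))
              (≢-sym (proper w r w~r))

  oddClosedWalk⇒¬H₁Torsion : ∀ {u} (C : Reachable X u u) → parity C ≡ true → ¬ H₁Torsion X
  oddClosedWalk⇒¬H₁Torsion {u} C odd torsion = 2k+1≢0 k (trans (sym sumC≡2k+1) sumC≡0)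
    where
    even : parity (C ++ʷ C) ≡ false
    even = trans (parity-++ C C) (xor-same (parity C))
    N : NbrWalk X u u
    N = halve (C ++ʷ C) even
    z : Chain1 X
    z = chain N , chain-vanishes N
    cycle : ∀ v → ∂₁ {X = X} z v ≡ 0ℤ
    cycle v = trans (∂₁≡∂ X z v) (trans (∂-chain N v) (ℤ.+-inverseʳ (δ u v)))
    sumN≡0 : nbrWalkSum φ N ≡ 0ℤ
    sumN≡0 = trans (sym (⟪⟫-chain φ φ-alternating N)) (⟪⟫-torsion X φ φ-cocycle z (torsion z cycle))
    sumC≡0 : walkSum φ C ≡ 0ℤ
    sumC≡0 = i+i≡0⇒i≡0 (walkSum φ C) (begin
      walkSum φ C + walkSum φ C                  ≡⟨ walkSum-++ φ C C ⟨
      walkSum φ (C ++ʷ C)                        ≡⟨ ℤ.+-identityˡ _ ⟨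
      + 2 * 0ℤ + walkSum φ (C ++ʷ C)             ≡⟨ cong (λ t → + 2 * t + walkSum φ (C ++ʷ C)) sumN≡0 ⟨
      + 2 * nbrWalkSum φ N + walkSum φ (C ++ʷ C)
        ≡⟨ walkSum-halve φ (λ x~y y~z → ω-path _ _ _ (proper _ _ x~y) (proper _ _ y~z)) (C ++ʷ C) even ⟩
      0ℤ                                      ∎)
    parityOfSumC : ∃ λ k → walkSum φ C ≡ + 2 * k + bit (parity C)
    parityOfSumC = walkSum-parity φ (λ x~y → ω-unit _ _ (proper _ _ x~y)) C
    k : ℤ
    k = proj₁ parityOfSumC
    sumC≡2k+1 : walkSum φ C ≡ + 2 * k + 1ℤ
    sumC≡2k+1 = trans (proj₂ parityOfSumC) (cong (λ b → + 2 * k + bit b) odd)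

colourable-mono : ∀ {n j k} (X : Graph n) → j ℕ.≤ k → Colourable X j → Colourable X k
colourable-mono X j≤k (f , proper) =
    (λ v → inject≤ (f v) j≤k)
  , λ u v u~v same → proper u v u~v (inject≤-injective j≤k j≤k (f u) (f v) same)

monochromaticEdge : ∀ {n k} (X : Graph n) (f : Fin n → Fin k) → ¬ ProperColouring X k f →
                    ∃₂ λ u v → Adj X u v × f u ≡ f v
monochromaticEdge {n} X f improper =
  pick (¬∀⟶∃¬ n _ (λ u → all? (¬? ∘ mono? u)) (λ none → improper λ u v u~v same → none u v (u~v , same)))
  where
  mono? : ∀ u v → Dec (Adj X u v × f u ≡ f v)
  mono? u v = (adj X u v Bool.≟ true) ×-dec (f u ≟ f v)
  pick : (∃ λ u → ¬ (∀ v → ¬ (Adj X u v × f u ≡ f v))) → ∃₂ λ u v → Adj X u v × f u ≡ f v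
  pick (u , ¬∀v) with v , ¬¬mono ← ¬∀⟶∃¬ n _ (¬? ∘ mono? u) ¬∀v =
    u , v , decidable-stable (mono? u v) ¬¬mono

-- Colouring every vertex by the parity of a walk from a base vertex fails to be proper,
-- and a monochromatic edge closes up an odd walk.
oddClosedWalk : ∀ {n} (X : Graph n) → Connected X → ¬ Bipartite X →
                ∃ λ u → Σ (Reachable X u u) λ C → parity C ≡ true
oddClosedWalk {zero}  X _    nonBipartite = contradiction ((λ ()) , λ ()) nonBipartite
oddClosedWalk {suc n} X conn nonBipartite =
  closeUp (monochromaticEdge X colour (nonBipartite ∘ (colour ,_)))
  where
  colour : Fin (suc n) → Fin 2
  colour v = Inverse.from 2↔Bool (parity (conn zero v))
  samePar : ∀ {u v} → colour u ≡ colour v → parity (conn zero u) ≡ parity (conn zero v)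
  samePar {u} {v} same = begin
    parity (conn zero u)                       ≡⟨ Inverse.strictlyInverseˡ 2↔Bool _ ⟨
    Inverse.to 2↔Bool (colour u)               ≡⟨ cong (Inverse.to 2↔Bool) same ⟩
    Inverse.to 2↔Bool (colour v)               ≡⟨ Inverse.strictlyInverseˡ 2↔Bool _ ⟩
    parity (conn zero v)                       ∎
  xor-not : ∀ b → b xor not b ≡ true
  xor-not b = trans (sym (not-distribʳ-xor b b)) (cong not (xor-same b))
  closeUp : (∃₂ λ u v → Adj X u v × colour u ≡ colour v) →
            ∃ λ u → Σ (Reachable X u u) λ C → parity C ≡ true
  closeUp (u , v , u~v , same) = zero , conn zero u ++ʷ step u~v (reverseʷ (conn zero v)) , (begin
    parity (conn zero u ++ʷ step u~v (reverseʷ (conn zero v)))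
      ≡⟨ parity-++ (conn zero u) _ ⟩
    parity (conn zero u) xor not (parity (reverseʷ (conn zero v)))
      ≡⟨ cong₂ (λ p q → p xor not q) (samePar same) (parity-reverse (conn zero v)) ⟩
    parity (conn zero v) xor not (parity (conn zero v))
      ≡⟨ xor-not (parity (conn zero v)) ⟩
    true ∎)

theorem1p4 : ∀ (n : ℕ) (X : Graph n) → Connected X → ¬ Bipartite X →
    H₁Torsion X → ChromaticAtLeast X 4
theorem1p4 n X conn nonBipartite torsion j j<4 colourable@(f , proper)
  with ℕ.m≤n⇒m<n∨m≡n (s≤s⁻¹ j<4)
... | inj₁ j<3  = nonBipartite (colourable-mono X (s≤s⁻¹ j<3) colourable)
... | inj₂ refl with u , C , odd ← oddClosedWalk X conn nonBipartite =
  oddClosedWalk⇒¬H₁Torsion X f proper C odd torsion
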